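{- Let $G$ be a graph on at most $5$ vertices. If $\mathbb{E}\rho(G)\ge 3/2$, then $G$ is isomorphic to a graph locally equivalent to the cycle $C_5$.
   Context: Graphs are finite and simple. $\rho_G(X)$ is the binary rank of the $X\times(V(G)\setminus X)$ adjacency submatrix; $\mathbb{E}\rho(G)=2^{ -|V(G)|}\sum_{S\subseteq V(G)}\rho_G(S)$. Local complementation at $v$ complements the induced subgraph on the neighborhood of $v$; two graphs are locally equivalent if one is obtained from the other by a sequence of local complementations. -}

module Defs where

open import Data.Nat using (ℕ; zero; suc; _+_; _*_; _^_; _≤_; _⊔_; _≡ᵇ_; _%_)
open import Data.Bool using (Bool; true; false; not; _∧_; _∨_; _xor_; if_then_else_)
open import Data.Bool.Properties using (∨-comm)
open import Data.Fin using (Fin; zero; suc; toℕ; _≟_)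
open import Data.Fin.Subset using (Subset; ∣_∣)
open import Data.Vec using (Vec; []; _∷_; lookup)
open import Data.List using (List; []; _∷_; map; _++_; foldr; foldl)
open import Data.Nat.ListAction using (sum)
open import Data.Product using (Σ; ∃; _×_; _,_)
open import Function.Bundles using (_⤖_; Bijection)
open import Relation.Binary.PropositionalEquality using (_≡_; refl)
open import Relation.Nullary.Decidable using (⌊_⌋)

record Graph (n : ℕ) : Set where
  field
    adj         : Fin n → Fin n → Bool
    symmetric   : ∀ i j → adj i j ≡ adj j i
    irreflexive : ∀ i → adj i i ≡ false
open Graph public

allSubsets : (n : ℕ) → List (Subset n)
allSubsets zero    = [] ∷ []
allSubsets (suc n) = map (false ∷_) (allSubsets n) ++ map (true ∷_) (allSubsets n)

allF : ∀ {n} → (Fin n → Bool) → Bool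
allF {zero}  f = true
allF {suc n} f = f zero ∧ allF (λ i → f (suc i))

anyF : ∀ {n} → (Fin n → Bool) → Bool
anyF {zero}  f = false
anyF {suc n} f = f zero ∨ anyF (λ i → f (suc i))

xorF : ∀ {n} → (Fin n → Bool) → Bool
xorF {zero}  f = false
xorF {suc n} f = f zero xor xorF (λ i → f (suc i))

_⊆ᵇ_ : ∀ {n} → Subset n → Subset n → Bool
T ⊆ᵇ S = allF (λ i → not (lookup T i) ∨ lookup S i)

nonemptyᵇ : ∀ {n} → Subset n → Bool
nonemptyᵇ T = anyF (lookup T)

-- Cut-rank over GF(2).
-- The matrix M = A[S, V∖S] has rows indexed by S, columns by V∖S.
-- GF(2)-sum of the rows indexed by T ⊆ S, as a function of the column j:
rowSum : ∀ {n} → Graph n → Subset n → Fin n → Bool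
rowSum G T j = xorF (λ i → lookup T i ∧ adj G i j)

-- the sum of rows T is the zero vector of M (entries at columns j ∉ S)
zeroRowᵇ : ∀ {n} → Graph n → Subset n → Subset n → Bool
zeroRowᵇ G S T = allF (λ j → lookup S j ∨ not (rowSum G T j))

-- rows of M indexed by T ⊆ S are linearly independent over GF(2):
-- no nonempty subfamily sums to zero.
independentᵇ : ∀ {n} → Graph n → Subset n → Subset n → Bool
independentᵇ {n} G S T =
  (T ⊆ᵇ S) ∧ allL (allSubsets n)
  where
  allL : List (Subset n) → Bool
  allL []        = true
  allL (U ∷ Us)  = (not ((U ⊆ᵇ T) ∧ nonemptyᵇ U) ∨ not (zeroRowᵇ G S U)) ∧ allL Us

-- ρ_G(S) = GF(2)-rank of A[S, V∖S] = maximum number of linearly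
-- independent rows.
ρ : ∀ {n} → Graph n → Subset n → ℕ
ρ {n} G S = foldr (λ T r → (if independentᵇ G S T then ∣ T ∣ else 0) ⊔ r) 0 (allSubsets n)

-- Σ_{S ⊆ V} ρ_G(S);  𝔼ρ(G) = sumρ G / 2^n
sumρ : ∀ {n} → Graph n → ℕ
sumρ {n} G = sum (map (ρ G) (allSubsets n))

lcAdj : ∀ {n} → (Fin n → Fin n → Bool) → Fin n → Fin n → Fin n → Bool
lcAdj a v i j =
  if a v i ∧ a v j ∧ not ⌊ i ≟ j ⌋ then not (a i j) else a i j

lcSeq : ∀ {n} → (Fin n → Fin n → Bool) → List (Fin n) → Fin n → Fin n → Bool
lcSeq a vs = foldl lcAdj a vs

-- H is obtained from G by a sequence of local complementations.
-- (Local complementation is an involution, so this relation is symmetric.)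
LocallyEquivalent : ∀ {n} → Graph n → Graph n → Set
LocallyEquivalent {n} G H =
  Σ (List (Fin n)) λ vs → ∀ i j → lcSeq (adj G) vs i j ≡ adj H i j

Isomorphic : ∀ {n m} → Graph n → Graph m → Set
Isomorphic {n} {m} G H =
  Σ (Fin n ⤖ Fin m) λ σ → ∀ i j → adj H (Bijection.to σ i) (Bijection.to σ j) ≡ adj G i j

succ5 : Fin 5 → Fin 5 → Bool
succ5 i j = (suc (toℕ i) % 5) ≡ᵇ toℕ j

c5adj : Fin 5 → Fin 5 → Bool
c5adj i j = succ5 i j ∨ succ5 j i

c5irr : ∀ i → c5adj i i ≡ false
c5irr zero = refl
c5irr (suc zero) = refl
c5irr (suc (suc zero)) = refl
c5irr (suc (suc (suc zero))) = refl
c5irr (suc (suc (suc (suc zero)))) = refl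

C5 : Graph 5
C5 = record
  { adj = c5adj
  ; symmetric = λ i j → ∨-comm (succ5 i j) (succ5 j i)
  ; irreflexive = c5irr
  }

-- Exhaustive computation. Every graph on n ≤ 5 vertices is enumerated
-- through its upper-triangular adjacency matrix and sumρ is evaluated on it.
-- For n ≤ 4 no graph reaches 2 sumρ ≥ 3·2ⁿ. For n = 5 every labelled graph
-- reaching it already lies in the orbit of C5 under local complementation
-- (132 labelled graphs, reached within five steps), so the isomorphism can be
-- the identity; a breadth-first search records for each member of the orbit
-- a sequence of local complementations producing it, and that sequence is
-- re-checked against the graph.
module Submission where

open import Defs
open import Data.Bool using (Bool; true; false; not; _∧_; _∨_; _xor_; if_then_else_; T)
open import Data.Bool.Properties using (T-∧; T-≡)
open import Data.Empty using (⊥-elim)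
open import Data.Fin using (Fin; zero; suc)
open import Data.Fin.Subset using (Subset; ∣_∣)
open import Data.List using (List; []; _∷_; [_]; _++_; foldl; allFin)
open import Data.List.Properties using (map-cong; foldr-cong)
open import Data.Nat using (ℕ; zero; suc; _*_; _^_; _≤_; _<ᵇ_; _⊔_; s≤s)
open import Data.Nat.ListAction using (sum)
open import Data.Nat.Properties using (<ᵇ⇒<; <⇒≱; ≤-refl; m≤n⇒m<n∨m≡n)
open import Data.Product using (Σ; _×_; _,_; proj₁; proj₂)
open import Data.Sum using (inj₁; inj₂)
open import Data.Unit using (⊤; tt)
open import Data.Vec using (Vec; []; _∷_; lookup; tabulate)
open import Data.Vec.Properties using (lookup∘tabulate)
open import Function.Bundles using (Equivalence)
open import Function.Construct.Identity using (⤖-id)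
open import Relation.Binary.PropositionalEquality using (_≡_; refl; sym; trans; cong; cong₂; subst)
open import Relation.Nullary using (¬_)

private
  variable
    n : ℕ

∧-split : ∀ {a b} → T (a ∧ b) → T a × T b
∧-split = Equivalence.to T-∧

T-from : ∀ {a} → a ≡ true → T a
T-from = Equivalence.from T-≡

AdjCode : ℕ → Set
AdjCode zero    = ⊤
AdjCode (suc n) = Vec Bool n × AdjCode n

decode : AdjCode n → Fin n → Fin n → Bool
decode (v , c) zero    zero    = false
decode (v , c) zero    (suc j) = lookup v j
decode (v , c) (suc i) zero    = lookup v i
decode (v , c) (suc i) (suc j) = decode c i j

decode-sym : (c : AdjCode n) → ∀ i j → decode c i j ≡ decode c j i
decode-sym (v , c) zero    zero    = refl
decode-sym (v , c) zero    (suc j) = refl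
decode-sym (v , c) (suc i) zero    = refl
decode-sym (v , c) (suc i) (suc j) = decode-sym c i j

decode-irrefl : (c : AdjCode n) → ∀ i → decode c i i ≡ false
decode-irrefl (v , c) zero    = refl
decode-irrefl (v , c) (suc i) = decode-irrefl c i

decodeGraph : AdjCode n → Graph n
decodeGraph c = record { adj = decode c ; symmetric = decode-sym c ; irreflexive = decode-irrefl c }

encode : (Fin n → Fin n → Bool) → AdjCode n
encode {zero}  a = tt
encode {suc n} a = tabulate (λ j → a zero (suc j)) , encode (λ i j → a (suc i) (suc j))

decode∘encode : (G : Graph n) → ∀ i j → decode (encode (adj G)) i j ≡ adj G i j
decode∘encode G zero    zero    = sym (irreflexive G zero)
decode∘encode G zero    (suc j) = lookup∘tabulate (λ j → adj G zero (suc j)) j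
decode∘encode G (suc i) zero    =
  trans (lookup∘tabulate (λ j → adj G zero (suc j)) i) (symmetric G zero (suc i))
decode∘encode G (suc i) (suc j) = decode∘encode tail i j
  where
  tail : Graph _
  tail = record
    { adj         = λ i j → adj G (suc i) (suc j)
    ; symmetric   = λ i j → symmetric G (suc i) (suc j)
    ; irreflexive = λ i → irreflexive G (suc i)
    }

allVecᵇ : ∀ k → (Vec Bool k → Bool) → Bool
allVecᵇ zero    p = p []
allVecᵇ (suc k) p = allVecᵇ k (λ v → p (false ∷ v)) ∧ allVecᵇ k (λ v → p (true ∷ v))

allVecᵇ-sound : ∀ k (p : Vec Bool k → Bool) → T (allVecᵇ k p) → ∀ v → T (p v)
allVecᵇ-sound zero    p h []          = h
allVecᵇ-sound (suc k) p h (false ∷ v) = allVecᵇ-sound k _ (proj₁ (∧-split h)) v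
allVecᵇ-sound (suc k) p h (true  ∷ v) = allVecᵇ-sound k _ (proj₂ (∧-split h)) v

allCodeᵇ : ∀ n → (AdjCode n → Bool) → Bool
allCodeᵇ zero    p = p tt
allCodeᵇ (suc n) p = allVecᵇ n (λ v → allCodeᵇ n (λ c → p (v , c)))

allCodeᵇ-sound : ∀ n (p : AdjCode n → Bool) → T (allCodeᵇ n p) → ∀ c → T (p c)
allCodeᵇ-sound zero    p h tt      = h
allCodeᵇ-sound (suc n) p h (v , c) = allCodeᵇ-sound n _ (allVecᵇ-sound n _ h v) c

allF-sound : (p : Fin n → Bool) → T (allF p) → ∀ i → T (p i)
allF-sound p h zero    = proj₁ (∧-split h)
allF-sound p h (suc i) = allF-sound (λ i → p (suc i)) (proj₂ (∧-split h)) i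

allF-cong : {p q : Fin n → Bool} → (∀ i → p i ≡ q i) → allF p ≡ allF q
allF-cong {zero}  e = refl
allF-cong {suc n} e = cong₂ _∧_ (e zero) (allF-cong (λ i → e (suc i)))

xorF-cong : {p q : Fin n → Bool} → (∀ i → p i ≡ q i) → xorF p ≡ xorF q
xorF-cong {zero}  e = refl
xorF-cong {suc n} e = cong₂ _xor_ (e zero) (xorF-cong (λ i → e (suc i)))

_≐_ : Graph n → Graph n → Set
G ≐ H = ∀ i j → adj G i j ≡ adj H i j

module _ {G H : Graph n} (G≐H : G ≐ H) where

  rowSum-cong : ∀ T j → rowSum G T j ≡ rowSum H T j
  rowSum-cong T j = xorF-cong (λ i → cong (lookup T i ∧_) (G≐H i j))

  zeroRowᵇ-cong : ∀ S U → zeroRowᵇ G S U ≡ zeroRowᵇ H S U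
  zeroRowᵇ-cong S U = allF-cong (λ j → cong (λ b → lookup S j ∨ not b) (rowSum-cong U j))

noZeroSubfamilyᵇ : Graph n → Subset n → Subset n → List (Subset n) → Bool
noZeroSubfamilyᵇ G S T []       = true
noZeroSubfamilyᵇ G S T (U ∷ Us) =
  (not ((U ⊆ᵇ T) ∧ nonemptyᵇ U) ∨ not (zeroRowᵇ G S U)) ∧ noZeroSubfamilyᵇ G S T Us

-- The helper list traversal inside independentᵇ cannot be named from outside
-- Defs; it agrees with noZeroSubfamilyᵇ by computation only once allSubsets n
-- is a concrete list, whence the bound on n.
independentᵇ-unfold : n ≤ 5 → (G : Graph n) → ∀ S T →
  independentᵇ G S T ≡ (T ⊆ᵇ S) ∧ noZeroSubfamilyᵇ G S T (allSubsets n)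
independentᵇ-unfold {0} _ G S T = refl
independentᵇ-unfold {1} _ G S T = refl
independentᵇ-unfold {2} _ G S T = refl
independentᵇ-unfold {3} _ G S T = refl
independentᵇ-unfold {4} _ G S T = refl
independentᵇ-unfold {5} _ G S T = refl
independentᵇ-unfold {suc (suc (suc (suc (suc (suc _)))))} (s≤s (s≤s (s≤s (s≤s (s≤s ())))))

noZeroSubfamilyᵇ-cong : {G H : Graph n} → G ≐ H → ∀ S T Us →
  noZeroSubfamilyᵇ G S T Us ≡ noZeroSubfamilyᵇ H S T Us
noZeroSubfamilyᵇ-cong             G≐H S T []       = refl
noZeroSubfamilyᵇ-cong {G = G} {H} G≐H S T (U ∷ Us) =
  cong₂ (λ z w → (not ((U ⊆ᵇ T) ∧ nonemptyᵇ U) ∨ not z) ∧ w)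
        (zeroRowᵇ-cong {G = G} {H} G≐H S U) (noZeroSubfamilyᵇ-cong {G = G} {H} G≐H S T Us)

sumρ-cong : n ≤ 5 → {G H : Graph n} → G ≐ H → sumρ G ≡ sumρ H
sumρ-cong {n} n≤5 {G} {H} G≐H = cong sum (map-cong ρ-cong (allSubsets n))
  where
  independentᵇ-cong : ∀ S T → independentᵇ G S T ≡ independentᵇ H S T
  independentᵇ-cong S T = trans (independentᵇ-unfold n≤5 G S T)
    (trans (cong ((T ⊆ᵇ S) ∧_) (noZeroSubfamilyᵇ-cong {G = G} {H} G≐H S T (allSubsets n)))
           (sym (independentᵇ-unfold n≤5 H S T)))

  ρ-cong : ∀ S → ρ G S ≡ ρ H S
  ρ-cong S = foldr-cong
    (λ T r → cong (λ b → (if b then ∣ T ∣ else 0) ⊔ r) (independentᵇ-cong S T)) refl (allSubsets n)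

Dense : Graph n → Set
Dense {n} G = 3 * 2 ^ n ≤ 2 * sumρ G

opaque
  sparseᵇ : AdjCode n → Bool
  sparseᵇ {n} c = 2 * sumρ (decodeGraph c) <ᵇ 3 * 2 ^ n

  sparseᵇ-sound : (c : AdjCode n) → T (sparseᵇ c) → ¬ Dense (decodeGraph c)
  sparseᵇ-sound {n} c h = <⇒≱ (<ᵇ⇒< (2 * sumρ (decodeGraph c)) (3 * 2 ^ n) h)

sparseᵇ-encode-sound : n ≤ 5 → (G : Graph n) → T (sparseᵇ (encode (adj G))) → ¬ Dense G
sparseᵇ-encode-sound {n} n≤5 G h dense =
  sparseᵇ-sound (encode (adj G)) h (subst (λ s → 3 * 2 ^ n ≤ 2 * s) sumρ-encode dense)
  where
  sumρ-encode : sumρ G ≡ sumρ (decodeGraph (encode (adj G)))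
  sumρ-encode = sumρ-cong n≤5 {G} (λ i j → sym (decode∘encode G i j))

noDenseGraph : n ≤ 5 → allCodeᵇ n sparseᵇ ≡ true → (G : Graph n) → ¬ Dense G
noDenseGraph {n} n≤5 all G =
  sparseᵇ-encode-sound n≤5 G (allCodeᵇ-sound n sparseᵇ (T-from all) (encode (adj G)))

sameAdjᵇ : (a b : Fin n → Fin n → Bool) → Bool
sameAdjᵇ a b = allF (λ i → allF (λ j → not (a i j xor b i j)))

sameAdjᵇ-sound : (a b : Fin n → Fin n → Bool) → T (sameAdjᵇ a b) → ∀ i j → a i j ≡ b i j
sameAdjᵇ-sound a b h i j =
  not-xor (a i j) (b i j) (allF-sound _ (allF-sound _ h i) j)
  where
  not-xor : ∀ x y → T (not (x xor y)) → x ≡ y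
  not-xor false false _ = refl
  not-xor true  true  _ = refl

codeEqᵇ : AdjCode n → AdjCode n → Bool
codeEqᵇ {zero}  _       _       = true
codeEqᵇ {suc n} (v , c) (w , d) = vecEqᵇ v w ∧ codeEqᵇ c d
  where
  vecEqᵇ : ∀ {k} → Vec Bool k → Vec Bool k → Bool
  vecEqᵇ []      []      = true
  vecEqᵇ (x ∷ v) (y ∷ w) = not (x xor y) ∧ vecEqᵇ v w

-- A graph together with the vertices at which to complement, in order, to reach it.
Reached : ℕ → Set
Reached n = AdjCode n × List (Fin n)

module _ {n : ℕ} where

  insertNew : Reached n → List (Reached n) → List (Reached n)
  insertNew r []       = [ r ]
  insertNew r (s ∷ rs) = if codeEqᵇ (proj₁ r) (proj₁ s) then s ∷ rs else s ∷ insertNew r rs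

  lcStep : List (Reached n) → List (Reached n)
  lcStep rs = foldl visit rs rs
    where
    visit : List (Reached n) → Reached n → List (Reached n)
    visit acc (c , vs) =
      foldl (λ acc′ v → insertNew (encode (lcAdj (decode c) v) , vs ++ [ v ]) acc′) acc (allFin n)

  lcBall : ℕ → AdjCode n → List (Reached n)
  lcBall zero    c = [ (c , []) ]
  lcBall (suc k) c = lcStep (lcBall k c)

  lcPath : List (Reached n) → AdjCode n → List (Fin n)
  lcPath []              c = []
  lcPath ((d , vs) ∷ rs) c = if codeEqᵇ c d then vs else lcPath rs c

-- Nothing is assumed of the list of candidates: the path it proposes is checked.
denseOnlyIfReachedᵇ : Graph n → List (Reached n) → AdjCode n → Bool
denseOnlyIfReachedᵇ B rs c = sameAdjᵇ (lcSeq (adj B) (lcPath rs c)) (decode c) ∨ sparseᵇ c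

-- The candidate list is an argument here so that evaluation computes it once.
-- The computed facts below are stated as _≡ true, since checking refl against
-- them is much faster than checking tt against T of them.
denseOnlyReachedᵇ : Graph n → List (Reached n) → Bool
denseOnlyReachedᵇ {n} B rs = allCodeᵇ n (denseOnlyIfReachedᵇ B rs)

denseLocallyEquivalent : n ≤ 5 → (B : Graph n) (rs : List (Reached n)) →
  denseOnlyReachedᵇ B rs ≡ true →
  (G : Graph n) → Dense G → Σ (Graph n) λ H → LocallyEquivalent B H × Isomorphic G H
denseLocallyEquivalent {n} n≤5 B rs all G dense =
  decodeGraph c , (lcPath rs c , reached (sameAdjᵇ lcB (decode c)) refl) , ⤖-id (Fin n) , decode∘encode G
  where
  c : AdjCode n
  c = encode (adj G)
  lcB : Fin n → Fin n → Bool
  lcB = lcSeq (adj B) (lcPath rs c)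
  reached : ∀ b → sameAdjᵇ lcB (decode c) ≡ b → ∀ i j → lcB i j ≡ decode c i j
  reached true  eq = sameAdjᵇ-sound lcB (decode c) (T-from eq)
  reached false eq = ⊥-elim (sparseᵇ-encode-sound n≤5 G sparse dense)
    where
    sparse : T (sparseᵇ c)
    sparse = subst (λ b → T (b ∨ sparseᵇ c)) eq (allCodeᵇ-sound n _ (T-from all) c)

c5Orbit : List (Reached 5)
c5Orbit = lcBall 5 (encode (adj C5))

opaque
  unfolding sparseᵇ

  smallGraphsSparse : n ≤ 4 → allCodeᵇ n sparseᵇ ≡ true
  smallGraphsSparse {0} _ = refl
  smallGraphsSparse {1} _ = refl
  smallGraphsSparse {2} _ = refl
  smallGraphsSparse {3} _ = refl
  smallGraphsSparse {4} _ = refl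
  smallGraphsSparse {suc (suc (suc (suc (suc _))))} (s≤s (s≤s (s≤s (s≤s ()))))

  denseOnlyInC5Orbit : denseOnlyReachedᵇ C5 c5Orbit ≡ true
  denseOnlyInC5Orbit = refl

lemma8p6 : (n : ℕ) → n ≤ 5 → (G : Graph n) →
    3 * 2 ^ n ≤ 2 * sumρ G →
    Σ (Graph 5) λ H → LocallyEquivalent C5 H × Isomorphic G H
lemma8p6 n n≤5 G dense with m≤n⇒m<n∨m≡n n≤5
... | inj₁ (s≤s n≤4) = ⊥-elim (noDenseGraph n≤5 (smallGraphsSparse n≤4) G dense)
... | inj₂ refl      = denseLocallyEquivalent ≤-refl C5 c5Orbit denseOnlyInC5Orbit G dense
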